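{- Let $G$ be an $(n-D)$-connected graph on vertex set $[n]$, where $D\le n$ is a positive integer, let $\sigma=\sigma_1\cdots\sigma_n$ be an ordering of $[n]$, and let $i$ be an integer with $D\le i<n$. Then $\sigma_i$ and $\sigma_{i+1}$ are connected by a path in $G$ all of whose vertices lie in $\{\sigma_1,\dots,\sigma_{i+1}\}$.
   Context: A graph is $k$-connected if for every set $S$ of fewer than $k$ vertices, the graph obtained by deleting $S$ is connected. An ordering of $[n]$ is a listing $\sigma_1\cdots\sigma_n$ of all its elements. -}

module Defs where

open import Data.Nat using (ℕ; _<_; _≤_)
open import Data.Fin using (Fin; toℕ)
open import Data.Fin.Subset using (Subset; _∈_; _∉_; ∣_∣)
open import Data.List using (List; []; _∷_)
open import Data.List.Relation.Unary.All using (All)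
open import Data.Product using (Σ; _×_)
open import Relation.Binary.PropositionalEquality using (_≡_)
open import Relation.Nullary using (¬_)
open import Level using (suc; _⊔_) renaming (zero to lzero)

record Graph (n : ℕ) : Set₁ where
  field
    Adj   : Fin n → Fin n → Set
    sym   : ∀ {u v} → Adj u v → Adj v u
    irrefl : ∀ {u} → ¬ Adj u u
open Graph public

data Walk {n : ℕ} (G : Graph n) : Fin n → Fin n → List (Fin n) → Set where
  single : ∀ u → Walk G u u (u ∷ [])
  step   : ∀ {u w v vs} → Adj G u w → Walk G w v vs → Walk G u v (u ∷ vs)

-- u and v are joined in G by a walk all of whose vertices satisfy P
-- (a walk exists iff a path exists, so this is "joined by a path inside P").
ConnectedWithin : ∀ {n} → Graph n → (Fin n → Set) → Fin n → Fin n → Set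
ConnectedWithin G P u v = Σ (List _) λ vs → Walk G u v vs × All P vs

ConnectedMinus : ∀ {n} → Graph n → Subset n → Set
ConnectedMinus G S = ∀ u v → u ∉ S → v ∉ S → ConnectedWithin G (λ x → x ∉ S) u v

KConnected : ∀ {n} → ℕ → Graph n → Set
KConnected {n} k G = (S : Subset n) → ∣ S ∣ < k → ConnectedMinus G S

-- An ordering of [n]: a bijection σ : Fin n → Fin n; σ_j (1-based) is σ at index j-1.
Ordering : ℕ → Set
Ordering n = Σ (Fin n → Fin n) λ σ → (∀ {a b} → σ a ≡ σ b → a ≡ b) × (∀ y → Σ (Fin n) λ x → σ x ≡ y)

{-# OPTIONS --safe #-}
-- Let S be the set of the n − i − 1 vertices σ_{i+2}, …, σ_n placed after position i + 1.
-- Since i ≥ D, S has fewer than n − D vertices, so G − S is connected; and the vertices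
-- of G − S are exactly σ_1, …, σ_{i+1}.
module Submission where

open import Defs
open import Data.Nat using (ℕ; suc; zero; _∸_; _≤_; _<_; _+_; z≤n; s≤s; _≤?_)
open import Data.Nat.Properties
  using (≤-<-trans; m∸n≤m; ≤-refl; ≤-trans; ≤-reflexive; +-monoʳ-≤; +-mono-≤; +-suc; n≤1+n; n<1+n;
         ≰⇒>; <⇒≱; ∸-monoʳ-≤; ∸-monoʳ-<; module ≤-Reasoning)
open import Data.Fin using (Fin; toℕ; fromℕ<; suc)
open import Data.Fin.Properties using (toℕ-fromℕ<)
open import Data.Fin.Subset using (Subset; _∈_; _∉_; ∣_∣; ⁅_⁆; _∪_; ⋃; inside; outside)
open import Data.Fin.Subset.Properties using (x∈⁅y⁆⇒x≡y; x∈⁅x⁆; ∉⊥; ∣⊥∣≡0; ∣⁅x⁆∣≡1; x∈p∪q⁻; x∈p∪q⁺)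
open import Data.Vec using ([]; _∷_)
open import Data.List using (List; []; _∷_; map; length; allFin)
open import Data.List.Properties using (length-map; length-tabulate)
import Data.List.Relation.Unary.All as All
open import Data.List.Relation.Unary.Any using (here; there)
open import Data.List.Membership.Propositional using () renaming (_∈_ to _∈ₗ_)
open import Data.List.Membership.Propositional.Properties using (∈-map⁺; ∈-map⁻; ∈-allFin)
open import Data.Product using (Σ; proj₁; _,_; _×_)
open import Data.Sum using ([_,_]′; inj₁; inj₂)
open import Data.Empty using (⊥-elim)
open import Function using (_∘_; id)
open import Relation.Binary.PropositionalEquality as ≡ using (_≡_; refl; trans; subst)
open import Relation.Nullary using (yes; no; contradiction)

∣p∪q∣≤∣p∣+∣q∣ : ∀ {n} (p q : Subset n) → ∣ p ∪ q ∣ ≤ ∣ p ∣ + ∣ q ∣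
∣p∪q∣≤∣p∣+∣q∣ []            []            = z≤n
∣p∪q∣≤∣p∣+∣q∣ (outside ∷ p) (outside ∷ q) = ∣p∪q∣≤∣p∣+∣q∣ p q
∣p∪q∣≤∣p∣+∣q∣ (outside ∷ p) (inside  ∷ q) =
  ≤-trans (s≤s (∣p∪q∣≤∣p∣+∣q∣ p q)) (≤-reflexive (≡.sym (+-suc ∣ p ∣ ∣ q ∣)))
∣p∪q∣≤∣p∣+∣q∣ (inside  ∷ p) (outside ∷ q) = s≤s (∣p∪q∣≤∣p∣+∣q∣ p q)
∣p∪q∣≤∣p∣+∣q∣ (inside  ∷ p) (inside  ∷ q) =
  s≤s (≤-trans (∣p∪q∣≤∣p∣+∣q∣ p q) (+-monoʳ-≤ ∣ p ∣ (n≤1+n ∣ q ∣)))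

fromList : ∀ {n} → List (Fin n) → Subset n
fromList = ⋃ ∘ map ⁅_⁆

∣fromList∣≤length : ∀ {n} (xs : List (Fin n)) → ∣ fromList xs ∣ ≤ length xs
∣fromList∣≤length {n} []       = ≤-reflexive (∣⊥∣≡0 n)
∣fromList∣≤length     (x ∷ xs) =
  ≤-trans (∣p∪q∣≤∣p∣+∣q∣ ⁅ x ⁆ (fromList xs))
          (+-mono-≤ (≤-reflexive (∣⁅x⁆∣≡1 x)) (∣fromList∣≤length xs))

∈-fromList⁺ : ∀ {n} {x : Fin n} {xs} → x ∈ₗ xs → x ∈ fromList xs
∈-fromList⁺ {x = x} (here refl) = x∈p∪q⁺ (inj₁ (x∈⁅x⁆ x))
∈-fromList⁺ (there x∈xs)        = x∈p∪q⁺ (inj₂ (∈-fromList⁺ x∈xs))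

∈-fromList⁻ : ∀ {n} {x : Fin n} {xs} → x ∈ fromList xs → x ∈ₗ xs
∈-fromList⁻ {xs = []}     = ⊥-elim ∘ ∉⊥
∈-fromList⁻ {xs = y ∷ ys} =
  [ here ∘ x∈⁅y⁆⇒x≡y y , there ∘ ∈-fromList⁻ ]′ ∘ x∈p∪q⁻ ⁅ y ⁆ (fromList ys)

finsFrom : ∀ {n} → ℕ → List (Fin n)
finsFrom {n}     zero    = allFin n
finsFrom {zero}  (suc m) = []
finsFrom {suc n} (suc m) = map suc (finsFrom m)

length-finsFrom : ∀ n m → length (finsFrom {n} m) ≡ n ∸ m
length-finsFrom n       zero    = length-tabulate id
length-finsFrom zero    (suc m) = refl
length-finsFrom (suc n) (suc m) = trans (length-map suc (finsFrom m)) (length-finsFrom n m)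

∈-finsFrom⁺ : ∀ {n m} (j : Fin n) → m ≤ toℕ j → j ∈ₗ finsFrom m
∈-finsFrom⁺ {m = zero}  j       _         = ∈-allFin j
∈-finsFrom⁺ {m = suc m} (suc j) (s≤s m≤j) = ∈-map⁺ suc (∈-finsFrom⁺ j m≤j)

∈-finsFrom⁻ : ∀ {n m} {j : Fin n} → j ∈ₗ finsFrom m → m ≤ toℕ j
∈-finsFrom⁻ {m = zero}        _  = z≤n
∈-finsFrom⁻ {suc n} {suc m} j∈ with ∈-map⁻ suc j∈
... | k , k∈ , refl = s≤s (∈-finsFrom⁻ k∈)

ConnectedWithin-mono : ∀ {n} {G : Graph n} {P Q : Fin n → Set} {u v} →
                       (∀ {x} → P x → Q x) → ConnectedWithin G P u v → ConnectedWithin G Q u v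
ConnectedWithin-mono P⇒Q (vs , walk , vs∈P) = vs , walk , All.map P⇒Q vs∈P

-- Positions are 0-based: PlacedUpTo σ i is {σ_1, …, σ_{i+1}}.
PlacedUpTo : ∀ {n} → Ordering n → ℕ → Fin n → Set
PlacedUpTo {n} σ i x = Σ (Fin n) λ j → toℕ j ≤ i × proj₁ σ j ≡ x

placedAfter : ∀ {n} → Ordering n → ℕ → Subset n
placedAfter (σ , _) i = fromList (map σ (finsFrom (suc i)))

∣placedAfter∣≤ : ∀ {n} (σ : Ordering n) i → ∣ placedAfter σ i ∣ ≤ n ∸ suc i
∣placedAfter∣≤ {n} (σ , _) i = begin
  ∣ fromList (map σ (finsFrom (suc i))) ∣  ≤⟨ ∣fromList∣≤length (map σ (finsFrom (suc i))) ⟩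
  length (map σ (finsFrom (suc i)))        ≡⟨ length-map σ (finsFrom (suc i)) ⟩
  length (finsFrom {n} (suc i))            ≡⟨ length-finsFrom n (suc i) ⟩
  n ∸ suc i                                ∎
  where open ≤-Reasoning

placedUpTo⇒∉placedAfter : ∀ {n} (σ : Ordering n) {i x} → PlacedUpTo σ i x → x ∉ placedAfter σ i
placedUpTo⇒∉placedAfter (σ , σ-injective , _) {i} (j , j≤i , refl) σj∈S
  with ∈-map⁻ σ (∈-fromList⁻ σj∈S)
... | k , k∈ , σj≡σk = <⇒≱ (∈-finsFrom⁻ k∈) (subst (λ l → toℕ l ≤ i) (σ-injective σj≡σk) j≤i)

∉placedAfter⇒placedUpTo : ∀ {n} (σ : Ordering n) {i x} → x ∉ placedAfter σ i → PlacedUpTo σ i x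
∉placedAfter⇒placedUpTo (σ , _ , σ-surjective) {i} {x} x∉S with σ-surjective x
... | j , refl with toℕ j ≤? i
...   | yes j≤i = j , j≤i , refl
...   | no  j≰i = contradiction (∈-fromList⁺ (∈-map⁺ σ (∈-finsFrom⁺ j (≰⇒> j≰i)))) x∉S

lemma8 : (n D : ℕ) → 1 ≤ D → D ≤ n → (G : Graph n) → KConnected (n ∸ D) G →
         (σ : Ordering n) → (i : ℕ) → D ≤ i → (i<n : i < n) →
         ConnectedWithin G (λ x → Σ (Fin n) λ j → toℕ j ≤ i × proj₁ σ j ≡ x)
           (proj₁ σ (fromℕ< {i ∸ 1} (≤-<-trans (m∸n≤m i 1) i<n)))
           (proj₁ σ (fromℕ< i<n))
lemma8 n D _ _ G G-connected σ i D≤i i<n =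
  ConnectedWithin-mono (∉placedAfter⇒placedUpTo σ)
    (G-connected (placedAfter σ i) ∣placedAfter∣<n∸D _ _
      (placedUpTo⇒∉placedAfter σ (placedAt (≤-<-trans (m∸n≤m i 1) i<n) (m∸n≤m i 1)))
      (placedUpTo⇒∉placedAfter σ (placedAt i<n ≤-refl)))
  where
  ∣placedAfter∣<n∸D : ∣ placedAfter σ i ∣ < n ∸ D
  ∣placedAfter∣<n∸D = begin-strict
    ∣ placedAfter σ i ∣  ≤⟨ ∣placedAfter∣≤ σ i ⟩
    n ∸ suc i            <⟨ ∸-monoʳ-< (n<1+n i) i<n ⟩
    n ∸ i                ≤⟨ ∸-monoʳ-≤ n D≤i ⟩
    n ∸ D                ∎
    where open ≤-Reasoning

  placedAt : ∀ {m} (m<n : m < n) → m ≤ i → PlacedUpTo σ i (proj₁ σ (fromℕ< m<n))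
  placedAt m<n m≤i = fromℕ< m<n , subst (_≤ i) (≡.sym (toℕ-fromℕ< m<n)) m≤i , refl
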